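{- Let $p$ be a prime and let $a$ be a positive integer. For every $k=1,\dots,p-1$, $$ {ap-1\brack k}_q\equiv(-1)^{k}q^{ -\binom{k+1}{2}}\left(1-a[p]_q\sum_{j=1}^{k}\frac{1}{[j]_q}\right)\pmod{[p]_q^2},$$ $$ {p-1+k\brack k}_q\equiv\frac{[p]_q}{[k]_q}\left(1+[p]_q\sum_{j=1}^{k-1}\frac{q^j}{[j]_q}\right)\pmod{[p]_q^3},$$ $$ {p-1+k\brack k}_q{p-1\brack k}_q^{ -1}\equiv \frac{(-1)^{k}q^{\binom{k+1}{2}}[p]_q}{[k]_q}\left(1+\frac{[p]_q}{[k]_q}+[p]_q\sum_{j=1}^{k-1}\frac{1+q^j}{[j]_q}\right)\pmod{[p]_q^3}.$$
   Context: For a nonnegative integer $n$, $[n]_q=\frac{1-q^n}{1-q}=1+q+\dots+q^{n-1}$, and $(a;q)_n=\prod_{j=0}^{n-1}(1-aq^j)$. The Gaussian $q$-binomial coefficient is ${n\brack k}_q=\frac{(q;q)_n}{(q;q)_k(q;q)_{n-k}}$ for $0\le k\le n$ and $0$ otherwise. Two rational functions in $q$ are said to be congruent modulo $[p]_q^r$ ($r\ge1$) if the numerator of their difference is divisible by $[p]_q^r$ in the polynomial ring $\mathbb{Z}[q]$ and the denominator is relatively prime to $[p]_q$. -}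

module Defs where

open import Data.Nat as ℕ using (ℕ; zero; suc; _≤?_)
open import Data.Integer as ℤ using (ℤ; +_; -[1+_])
open import Data.List using (List; []; _∷_; map; replicate; _++_)
open import Data.Product using (Σ; ∃; _×_; _,_)
open import Relation.Binary.PropositionalEquality using (_≡_)
open import Relation.Nullary using (yes; no)

-- Polynomials in ℤ[q]: coefficient lists, lowest degree first.
-- Equality is coefficientwise (so trailing zeros are irrelevant).

Poly : Set
Poly = List ℤ

coeff : Poly → ℕ → ℤ
coeff []       _       = + 0
coeff (x ∷ xs) zero    = x
coeff (x ∷ xs) (suc n) = coeff xs n

infix 4 _≈P_
_≈P_ : Poly → Poly → Set
f ≈P g = ∀ n → coeff f n ≡ coeff g n

infixl 6 _+P_ _-P_
infixl 7 _*P_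

_+P_ : Poly → Poly → Poly
[]       +P ys       = ys
(x ∷ xs) +P []       = x ∷ xs
(x ∷ xs) +P (y ∷ ys) = (x ℤ.+ y) ∷ (xs +P ys)

scaleP : ℤ → Poly → Poly
scaleP c = map (c ℤ.*_)

negP : Poly → Poly
negP = scaleP (ℤ.- (+ 1))

_-P_ : Poly → Poly → Poly
f -P g = f +P negP g

_*P_ : Poly → Poly → Poly
[]       *P ys = []
(x ∷ xs) *P ys = scaleP x ys +P (+ 0 ∷ (xs *P ys))

constP : ℤ → Poly
constP c = c ∷ []

0P 1P : Poly
0P = []
1P = constP (+ 1)

qP : Poly
qP = + 0 ∷ + 1 ∷ []

_^P_ : Poly → ℕ → Poly
f ^P zero  = 1P
f ^P suc n = f *P (f ^P n)

-- [n]_q = 1 + q + ... + q^(n-1)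
qint : ℕ → Poly
qint n = replicate n (+ 1)

qPoch : Poly → ℕ → Poly
qPoch a zero    = 1P
qPoch a (suc n) = qPoch a n *P (1P -P a *P (qP ^P n))

infix 4 _∣P_
_∣P_ : Poly → Poly → Set
d ∣P f = Σ Poly (λ c → c *P d ≈P f)

CoprimeP : Poly → Poly → Set
CoprimeP f g = ∀ d → d ∣P f → d ∣P g → d ∣P 1P

-- Rational functions in q, as formal fractions num/den.

record RatF : Set where
  constructor _//_
  field
    num : Poly
    den : Poly
open RatF public

infixl 6 _+R_ _-R_
infixl 7 _*R_

fromP : Poly → RatF
fromP f = f // 1P

_+R_ : RatF → RatF → RatF
(a // b) +R (c // d) = (a *P d +P c *P b) // (b *P d)

_-R_ : RatF → RatF → RatF
(a // b) -R (c // d) = (a *P d -P c *P b) // (b *P d)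

_*R_ : RatF → RatF → RatF
(a // b) *R (c // d) = (a *P c) // (b *P d)

invR : RatF → RatF
invR (a // b) = b // a

0R 1R : RatF
0R = fromP 0P
1R = fromP 1P

sumR : (ℕ → RatF) → ℕ → RatF
sumR f zero    = 0R
sumR f (suc k) = sumR f k +R f (suc k)

gaussB : ℕ → ℕ → RatF
gaussB n k with k ≤? n
... | yes _ = qPoch qP n // (qPoch qP k *P qPoch qP (n ℕ.∸ k))
... | no  _ = 0R

-- Congruence of rational functions modulo m^r:
-- f - g = A/B with m^r ∣ A and B relatively prime to m.
CongR : Poly → ℕ → RatF → RatF → Set
CongR m r (a // b) (c // d) =
  Σ Poly λ A → Σ Poly λ B →
    (m ^P r ∣P A) × CoprimeP B m ×
    (A *P (b *P d) ≈P B *P (a *P d -P c *P b))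

signR : ℕ → RatF
signR k = fromP (constP (-[1+ 0 ] ℤ.^ k))

module Submission where

open import Defs
open import Data.Nat using (ℕ; _*_; _∸_; _+_; _≤_; _<_)
open import Data.Nat.Primality using (Prime)
open import Data.Nat.Combinatorics using (_C_)
open import Data.Integer using (+_)
open import Data.Product using (_×_)

open import Data.Nat using (zero; suc; z≤n; s≤s; >-nonZero)
import Data.Nat.Properties as ℕ
open import Data.Nat.Combinatorics using (nCk+nC[k+1]≡[n+1]C[k+1]; nC1≡n)
open import Data.Nat.Primality using (¬prime[0])
open import Data.Nat.Coprimality as Coprime using (prime⇒coprime; coprime-Bézout)
open import Data.Nat.GCD using (module Bézout)
open import Data.Integer as ℤ using (-[1+_])
import Data.Integer.Properties as ℤ
open import Data.List using ([]; _∷_)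
open import Data.Product using (Σ; _,_)
open import Data.Maybe using (Maybe; just; nothing)
open import Data.Empty using (⊥-elim)
open import Relation.Nullary using (yes; no; contradiction)
open import Relation.Binary.PropositionalEquality as ≡ using (_≡_; refl; cong; cong₂; subst)
open import Relation.Binary.Bundles using (Setoid)
open import Relation.Binary.Structures using (IsEquivalence)
open import Algebra.Bundles using (CommutativeRing)
open import Tactic.RingSolver.Core.AlmostCommutativeRing using (AlmostCommutativeRing; fromCommutativeRing)
open import Tactic.RingSolver using (solve-∀)
import Relation.Binary.Reasoning.Setoid as SetoidReasoning

-- Coefficientwise equality of polynomials, wrapped in a record so that
-- Agda can infer the two polynomials it relates.

infix 4 _≋_
record _≋_ (f g : Poly) : Set where
  constructor mk
  field coeffs : f ≈P g
open _≋_

≋-refl : ∀ {f} → f ≋ f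
≋-refl = mk λ n → refl

≋-sym : ∀ {f g} → f ≋ g → g ≋ f
≋-sym (mk e) = mk λ n → ≡.sym (e n)

≋-trans : ∀ {f g h} → f ≋ g → g ≋ h → f ≋ h
≋-trans (mk e₁) (mk e₂) = mk λ n → ≡.trans (e₁ n) (e₂ n)

≋-isEquivalence : IsEquivalence _≋_
≋-isEquivalence = record { refl = ≋-refl ; sym = ≋-sym ; trans = ≋-trans }

≋-setoid : Setoid _ _
≋-setoid = record { Carrier = Poly ; _≈_ = _≋_ ; isEquivalence = ≋-isEquivalence }

module ≋-Reasoning = SetoidReasoning ≋-setoid

≡⇒≋ : ∀ {f g} → f ≡ g → f ≋ g
≡⇒≋ refl = ≋-refl

∷-cong : ∀ {x y f g} → x ≡ y → f ≋ g → (x ∷ f) ≋ (y ∷ g)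
∷-cong x≡y (mk e) = mk λ { zero → x≡y ; (suc n) → e n }

∷-injective : ∀ {x y f g} → (x ∷ f) ≋ (y ∷ g) → x ≡ y × f ≋ g
∷-injective (mk e) = e 0 , mk λ n → e (suc n)

0∷[]≋[] : (+ 0 ∷ []) ≋ []
0∷[]≋[] = mk λ { zero → refl ; (suc n) → refl }

coeff-+P : ∀ f g n → coeff (f +P g) n ≡ coeff f n ℤ.+ coeff g n
coeff-+P []      g       n       = ≡.sym (ℤ.+-identityˡ _)
coeff-+P (x ∷ f) []      n       = ≡.sym (ℤ.+-identityʳ _)
coeff-+P (x ∷ f) (y ∷ g) zero    = refl
coeff-+P (x ∷ f) (y ∷ g) (suc n) = coeff-+P f g n

coeff-scaleP : ∀ c f n → coeff (scaleP c f) n ≡ c ℤ.* coeff f n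
coeff-scaleP c []      n       = ≡.sym (ℤ.*-zeroʳ c)
coeff-scaleP c (x ∷ f) zero    = refl
coeff-scaleP c (x ∷ f) (suc n) = coeff-scaleP c f n

+P-cong : ∀ {f f′ g g′} → f ≋ f′ → g ≋ g′ → (f +P g) ≋ (f′ +P g′)
+P-cong {f} {f′} {g} {g′} (mk e₁) (mk e₂) = mk λ n → begin
  coeff (f +P g) n            ≡⟨ coeff-+P f g n ⟩
  coeff f n ℤ.+ coeff g n     ≡⟨ cong₂ ℤ._+_ (e₁ n) (e₂ n) ⟩
  coeff f′ n ℤ.+ coeff g′ n   ≡⟨ coeff-+P f′ g′ n ⟨
  coeff (f′ +P g′) n          ∎
  where open ≡.≡-Reasoning

+P-congˡ : ∀ {f f′} g → f ≋ f′ → (f +P g) ≋ (f′ +P g)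
+P-congˡ g e = +P-cong e (≋-refl {g})

+P-congʳ : ∀ f {g g′} → g ≋ g′ → (f +P g) ≋ (f +P g′)
+P-congʳ f e = +P-cong (≋-refl {f}) e

+P-comm : ∀ f g → (f +P g) ≋ (g +P f)
+P-comm f g = mk λ n → begin
  coeff (f +P g) n          ≡⟨ coeff-+P f g n ⟩
  coeff f n ℤ.+ coeff g n   ≡⟨ ℤ.+-comm (coeff f n) _ ⟩
  coeff g n ℤ.+ coeff f n   ≡⟨ coeff-+P g f n ⟨
  coeff (g +P f) n          ∎
  where open ≡.≡-Reasoning

+P-assoc : ∀ f g h → ((f +P g) +P h) ≋ (f +P (g +P h))
+P-assoc f g h = mk λ n → begin
  coeff ((f +P g) +P h) n                      ≡⟨ coeff-+P (f +P g) h n ⟩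
  coeff (f +P g) n ℤ.+ coeff h n               ≡⟨ cong (ℤ._+ coeff h n) (coeff-+P f g n) ⟩
  (coeff f n ℤ.+ coeff g n) ℤ.+ coeff h n      ≡⟨ ℤ.+-assoc (coeff f n) _ _ ⟩
  coeff f n ℤ.+ (coeff g n ℤ.+ coeff h n)      ≡⟨ cong (λ z → coeff f n ℤ.+ z) (coeff-+P g h n) ⟨
  coeff f n ℤ.+ coeff (g +P h) n               ≡⟨ coeff-+P f (g +P h) n ⟨
  coeff (f +P (g +P h)) n                      ∎
  where open ≡.≡-Reasoning

+P-identityʳ : ∀ f → (f +P []) ≋ f
+P-identityʳ []      = ≋-refl
+P-identityʳ (x ∷ f) = ≋-refl

+P-swap : ∀ f g h → (f +P (g +P h)) ≋ (g +P (f +P h))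
+P-swap f g h = ≋-trans (≋-sym (+P-assoc f g h))
                (≋-trans (+P-congˡ h (+P-comm f g)) (+P-assoc g f h))

scaleP-cong : ∀ c {f g} → f ≋ g → scaleP c f ≋ scaleP c g
scaleP-cong c {f} {g} (mk e) = mk λ n →
  ≡.trans (coeff-scaleP c f n) (≡.trans (cong (c ℤ.*_) (e n)) (≡.sym (coeff-scaleP c g n)))

scaleP-+P : ∀ c f g → scaleP c (f +P g) ≋ (scaleP c f +P scaleP c g)
scaleP-+P c f g = mk λ n → begin
  coeff (scaleP c (f +P g)) n                       ≡⟨ coeff-scaleP c (f +P g) n ⟩
  c ℤ.* coeff (f +P g) n                            ≡⟨ cong (c ℤ.*_) (coeff-+P f g n) ⟩
  c ℤ.* (coeff f n ℤ.+ coeff g n)                   ≡⟨ ℤ.*-distribˡ-+ c (coeff f n) _ ⟩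
  c ℤ.* coeff f n ℤ.+ c ℤ.* coeff g n               ≡⟨ cong₂ ℤ._+_ (coeff-scaleP c f n) (coeff-scaleP c g n) ⟨
  coeff (scaleP c f) n ℤ.+ coeff (scaleP c g) n     ≡⟨ coeff-+P (scaleP c f) _ n ⟨
  coeff (scaleP c f +P scaleP c g) n                ∎
  where open ≡.≡-Reasoning

scaleP-distrib : ∀ c d f → scaleP (c ℤ.+ d) f ≋ (scaleP c f +P scaleP d f)
scaleP-distrib c d f = mk λ n → begin
  coeff (scaleP (c ℤ.+ d) f) n                      ≡⟨ coeff-scaleP (c ℤ.+ d) f n ⟩
  (c ℤ.+ d) ℤ.* coeff f n                           ≡⟨ ℤ.*-distribʳ-+ (coeff f n) c d ⟩
  c ℤ.* coeff f n ℤ.+ d ℤ.* coeff f n               ≡⟨ cong₂ ℤ._+_ (coeff-scaleP c f n) (coeff-scaleP d f n) ⟨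
  coeff (scaleP c f) n ℤ.+ coeff (scaleP d f) n     ≡⟨ coeff-+P (scaleP c f) _ n ⟨
  coeff (scaleP c f +P scaleP d f) n                ∎
  where open ≡.≡-Reasoning

scaleP-scaleP : ∀ c d f → scaleP c (scaleP d f) ≋ scaleP (c ℤ.* d) f
scaleP-scaleP c d f = mk λ n → begin
  coeff (scaleP c (scaleP d f)) n    ≡⟨ coeff-scaleP c (scaleP d f) n ⟩
  c ℤ.* coeff (scaleP d f) n         ≡⟨ cong (c ℤ.*_) (coeff-scaleP d f n) ⟩
  c ℤ.* (d ℤ.* coeff f n)            ≡⟨ ℤ.*-assoc c d _ ⟨
  (c ℤ.* d) ℤ.* coeff f n            ≡⟨ coeff-scaleP (c ℤ.* d) f n ⟨
  coeff (scaleP (c ℤ.* d) f) n       ∎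
  where open ≡.≡-Reasoning

scaleP-0 : ∀ f → scaleP (+ 0) f ≋ []
scaleP-0 f = mk λ n → coeff-scaleP (+ 0) f n

scaleP-1 : ∀ f → scaleP (+ 1) f ≋ f
scaleP-1 f = mk λ n → ≡.trans (coeff-scaleP (+ 1) f n) (ℤ.*-identityˡ _)

negP-cong : ∀ {f g} → f ≋ g → negP f ≋ negP g
negP-cong = scaleP-cong -[1+ 0 ]

negP-inverseʳ : ∀ f → (f +P negP f) ≋ []
negP-inverseʳ f = mk λ n → begin
  coeff (f +P negP f) n                   ≡⟨ coeff-+P f (negP f) n ⟩
  coeff f n ℤ.+ coeff (negP f) n          ≡⟨ cong (λ z → coeff f n ℤ.+ z) (coeff-scaleP -[1+ 0 ] f n) ⟩
  coeff f n ℤ.+ -[1+ 0 ] ℤ.* coeff f n    ≡⟨ cong (λ z → coeff f n ℤ.+ z) (ℤ.-1*i≡-i (coeff f n)) ⟩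
  coeff f n ℤ.+ ℤ.- coeff f n             ≡⟨ ℤ.+-inverseʳ (coeff f n) ⟩
  + 0                                     ∎
  where open ≡.≡-Reasoning

*P-zeroˡ : ∀ {f} g → f ≋ [] → (f *P g) ≋ []
*P-zeroˡ {[]}    g f≋0 = ≋-refl
*P-zeroˡ {x ∷ f} g f≋0 with ∷-injective (≋-trans f≋0 (≋-sym 0∷[]≋[]))
... | x≡0 , f≋[] =
  ≋-trans (+P-cong (≋-trans (≡⇒≋ (cong (λ c → scaleP c g) x≡0)) (scaleP-0 g))
                   (≋-trans (∷-cong refl (*P-zeroˡ g f≋[])) 0∷[]≋[]))
          ≋-refl

*P-zeroʳ : ∀ f → (f *P []) ≋ []
*P-zeroʳ []      = ≋-refl
*P-zeroʳ (x ∷ f) = ≋-trans (∷-cong refl (*P-zeroʳ f)) 0∷[]≋[]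

*P-congˡ : ∀ {f f′} g → f ≋ f′ → (f *P g) ≋ (f′ *P g)
*P-congˡ {[]}    {f′}     g e = ≋-sym (*P-zeroˡ g (≋-sym e))
*P-congˡ {x ∷ f} {[]}     g e = *P-zeroˡ g e
*P-congˡ {x ∷ f} {y ∷ f′} g e with ∷-injective e
... | x≡y , f≋f′ = +P-cong (≡⇒≋ (cong (λ c → scaleP c g) x≡y)) (∷-cong refl (*P-congˡ g f≋f′))

*P-congʳ : ∀ f {g g′} → g ≋ g′ → (f *P g) ≋ (f *P g′)
*P-congʳ []      e = ≋-refl
*P-congʳ (x ∷ f) e = +P-cong (scaleP-cong x e) (∷-cong refl (*P-congʳ f e))

*P-cong : ∀ {f f′ g g′} → f ≋ f′ → g ≋ g′ → (f *P g) ≋ (f′ *P g′)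
*P-cong {f} {f′} {g} e₁ e₂ = ≋-trans (*P-congˡ g e₁) (*P-congʳ f′ e₂)

*P-distribʳ : ∀ f g h → ((f +P g) *P h) ≋ ((f *P h) +P (g *P h))
*P-distribʳ []      g       h = ≋-refl
*P-distribʳ (x ∷ f) []      h = ≋-sym (+P-identityʳ _)
*P-distribʳ (x ∷ f) (y ∷ g) h = begin
  scaleP (x ℤ.+ y) h +P (+ 0 ∷ ((f +P g) *P h))
    ≈⟨ +P-cong (scaleP-distrib x y h) (∷-cong refl (*P-distribʳ f g h)) ⟩
  (scaleP x h +P scaleP y h) +P ((+ 0 ∷ (f *P h)) +P (+ 0 ∷ (g *P h)))
    ≈⟨ +P-assoc (scaleP x h) _ _ ⟩
  scaleP x h +P (scaleP y h +P ((+ 0 ∷ (f *P h)) +P (+ 0 ∷ (g *P h))))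
    ≈⟨ +P-congʳ (scaleP x h) (+P-swap (scaleP y h) (+ 0 ∷ (f *P h)) (+ 0 ∷ (g *P h))) ⟩
  scaleP x h +P ((+ 0 ∷ (f *P h)) +P (scaleP y h +P (+ 0 ∷ (g *P h))))
    ≈⟨ +P-assoc (scaleP x h) _ _ ⟨
  (x ∷ f) *P h +P (y ∷ g) *P h ∎
  where open ≋-Reasoning

scaleP-*P : ∀ c f g → (scaleP c f *P g) ≋ scaleP c (f *P g)
scaleP-*P c []      g = ≋-refl
scaleP-*P c (x ∷ f) g =
  ≋-trans (+P-cong (≋-sym (scaleP-scaleP c x g)) (∷-cong (≡.sym (ℤ.*-zeroʳ c)) (scaleP-*P c f g)))
          (≋-sym (scaleP-+P c (scaleP x g) _))

*P-∷ʳ : ∀ f y g → (f *P (y ∷ g)) ≋ (scaleP y f +P (+ 0 ∷ (f *P g)))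
*P-∷ʳ []      y g = ≋-sym (≋-trans (+P-identityʳ _) 0∷[]≋[])
*P-∷ʳ (x ∷ f) y g = begin
  scaleP x (y ∷ g) +P (+ 0 ∷ (f *P (y ∷ g)))
    ≈⟨ +P-congʳ (scaleP x (y ∷ g)) (∷-cong refl (*P-∷ʳ f y g)) ⟩
  (x ℤ.* y ℤ.+ + 0) ∷ (scaleP x g +P (scaleP y f +P (+ 0 ∷ (f *P g))))
    ≈⟨ ∷-cong (cong (ℤ._+ + 0) (ℤ.*-comm x y)) (+P-swap (scaleP x g) (scaleP y f) (+ 0 ∷ (f *P g))) ⟩
  (y ℤ.* x ℤ.+ + 0) ∷ (scaleP y f +P (scaleP x g +P (+ 0 ∷ (f *P g)))) ∎
  where open ≋-Reasoning

*P-comm : ∀ f g → (f *P g) ≋ (g *P f)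
*P-comm []      g = ≋-sym (*P-zeroʳ g)
*P-comm (x ∷ f) g =
  ≋-trans (+P-congʳ (scaleP x g) (∷-cong refl (*P-comm f g))) (≋-sym (*P-∷ʳ g x f))

*P-assoc : ∀ f g h → ((f *P g) *P h) ≋ (f *P (g *P h))
*P-assoc []      g h = ≋-refl
*P-assoc (x ∷ f) g h =
  ≋-trans (*P-distribʳ (scaleP x g) _ h)
          (+P-cong (scaleP-*P x g h)
                   (≋-trans (+P-congˡ (+ 0 ∷ ((f *P g) *P h)) (scaleP-0 h)) (∷-cong refl (*P-assoc f g h))))

*P-distribˡ : ∀ f g h → (f *P (g +P h)) ≋ ((f *P g) +P (f *P h))
*P-distribˡ f g h =
  ≋-trans (*P-comm f (g +P h)) (≋-trans (*P-distribʳ g h f) (+P-cong (*P-comm g f) (*P-comm h f)))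

*P-identityˡ : ∀ f → (1P *P f) ≋ f
*P-identityˡ f = ≋-trans (+P-cong (scaleP-1 f) 0∷[]≋[]) (+P-identityʳ f)

*P-identityʳ : ∀ f → (f *P 1P) ≋ f
*P-identityʳ f = ≋-trans (*P-comm f 1P) (*P-identityˡ f)

polyCommRing : CommutativeRing _ _
polyCommRing = record
  { Carrier = Poly ; _≈_ = _≋_ ; _+_ = _+P_ ; _*_ = _*P_ ; -_ = negP ; 0# = [] ; 1# = 1P
  ; isCommutativeRing = record
    { isRing = record
      { +-isAbelianGroup = record
        { isGroup = record
          { isMonoid = record
            { isSemigroup = record
              { isMagma = record { isEquivalence = ≋-isEquivalence ; ∙-cong = +P-cong }
              ; assoc = +P-assoc }
            ; identity = (λ f → ≋-refl) , +P-identityʳ }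
          ; inverse = (λ f → ≋-trans (+P-comm (negP f) f) (negP-inverseʳ f)) , negP-inverseʳ
          ; ⁻¹-cong = negP-cong }
        ; comm = +P-comm }
      ; *-cong = *P-cong
      ; *-assoc = *P-assoc
      ; *-identity = *P-identityˡ , *P-identityʳ
      ; distrib = *P-distribˡ , (λ f g h → *P-distribʳ g h f) }
    ; *-comm = *P-comm } }

-- A (partial) zero test, which the ring solver uses to simplify constants.
isZero? : (f : Poly) → Maybe ([] ≋ f)
isZero? []      = just ≋-refl
isZero? (x ∷ f) with x ℤ.≟ + 0 | isZero? f
... | yes refl | just []≋f = just (≋-trans (≋-sym 0∷[]≋[]) (∷-cong refl []≋f))
... | _        | _         = nothing

polyRing : AlmostCommutativeRing _ _
polyRing = fromCommutativeRing polyCommRing isZero?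

-- q-integers and powers of q

qP*P : ∀ f → (qP *P f) ≋ (+ 0 ∷ f)
qP*P f = ≋-trans (+P-cong (scaleP-0 f) (∷-cong refl (*P-identityˡ f))) ≋-refl

qint-suc : ∀ m → qint (suc m) ≋ (1P +P qP *P qint m)
qint-suc m = ≋-sym (≋-trans (+P-congʳ 1P (qP*P (qint m))) (∷-cong (ℤ.+-identityʳ (+ 1)) ≋-refl))

qpow-+ : ∀ a b → qP ^P (a + b) ≋ (qP ^P a *P qP ^P b)
qpow-+ zero    b = ≋-sym (*P-identityˡ _)
qpow-+ (suc a) b = ≋-trans (*P-congʳ qP (qpow-+ a b)) (≋-sym (*P-assoc qP (qP ^P a) _))

qint-+ : ∀ a b → qint (a + b) ≋ (qint a +P qP ^P a *P qint b)
qint-+ zero    b = ≋-sym (*P-identityˡ _)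
qint-+ (suc a) b = begin
  qint (suc (a + b))                              ≈⟨ qint-suc (a + b) ⟩
  1P +P qP *P qint (a + b)                        ≈⟨ +P-congʳ 1P (*P-congʳ qP (qint-+ a b)) ⟩
  1P +P qP *P (qint a +P qP ^P a *P qint b)       ≈⟨ regroup qP (qint a) (qP ^P a) (qint b) ⟩
  (1P +P qP *P qint a) +P (qP *P qP ^P a) *P qint b ≈⟨ +P-congˡ ((qP *P qP ^P a) *P qint b) (qint-suc a) ⟨
  qint (suc a) +P qP ^P suc a *P qint b           ∎
  where
  open ≋-Reasoning
  regroup : ∀ q A Q B → (1P +P q *P (A +P Q *P B)) ≋ ((1P +P q *P A) +P (q *P Q) *P B)
  regroup = solve-∀ polyRing

qint-∸ : ∀ m j → j ≤ m → (qP ^P j *P qint (m ∸ j)) ≋ (qint m -P qint j)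
qint-∸ m j j≤m = begin
  qP ^P j *P qint (m ∸ j)                           ≈⟨ add-sub (qint j) _ ⟩
  (qint j +P qP ^P j *P qint (m ∸ j)) -P qint j     ≈⟨ +P-congˡ (negP (qint j)) (qint-+ j (m ∸ j)) ⟨
  qint (j + (m ∸ j)) -P qint j                      ≈⟨ +P-congˡ (negP (qint j)) (≡⇒≋ (cong qint (ℕ.m+[n∸m]≡n j≤m))) ⟩
  qint m -P qint j                                  ∎
  where
  open ≋-Reasoning
  add-sub : ∀ J Y → Y ≋ ((J +P Y) -P J)
  add-sub = solve-∀ polyRing

one-minus-qpow : ∀ m → (1P -P qP ^P m) ≋ ((1P -P qP) *P qint m)
one-minus-qpow zero    = ≋-trans (negP-inverseʳ 1P) (≋-sym (*P-zeroʳ (1P -P qP)))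
one-minus-qpow (suc m) = begin
  1P -P qP *P qP ^P m                       ≈⟨ split qP (qP ^P m) ⟩
  (1P -P qP) +P qP *P (1P -P qP ^P m)       ≈⟨ +P-congʳ (1P -P qP) (*P-congʳ qP (one-minus-qpow m)) ⟩
  (1P -P qP) +P qP *P ((1P -P qP) *P qint m) ≈⟨ factor qP (qint m) ⟩
  (1P -P qP) *P (1P +P qP *P qint m)        ≈⟨ *P-congʳ (1P -P qP) (qint-suc m) ⟨
  (1P -P qP) *P qint (suc m)                ∎
  where
  open ≋-Reasoning
  split : ∀ q Q → (1P -P q *P Q) ≋ ((1P -P q) +P q *P (1P -P Q))
  split = solve-∀ polyRing
  factor : ∀ q M → ((1P -P q) +P q *P ((1P -P q) *P M)) ≋ ((1P -P q) *P (1P +P q *P M))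
  factor = solve-∀ polyRing

geomSum : ℕ → ℕ → Poly
geomSum n zero    = []
geomSum n (suc x) = 1P +P qP ^P n *P geomSum n x

qint-* : ∀ x n → qint (x * n) ≋ (qint n *P geomSum n x)
qint-* zero    n = ≋-sym (*P-zeroʳ (qint n))
qint-* (suc x) n = begin
  qint (n + x * n)                                 ≈⟨ qint-+ n (x * n) ⟩
  qint n +P qP ^P n *P qint (x * n)                ≈⟨ +P-congʳ (qint n) (*P-congʳ (qP ^P n) (qint-* x n)) ⟩
  qint n +P qP ^P n *P (qint n *P geomSum n x)     ≈⟨ factor (qint n) (qP ^P n) (geomSum n x) ⟩
  qint n *P (1P +P qP ^P n *P geomSum n x)         ∎
  where
  open ≋-Reasoning
  factor : ∀ A Q B → (A +P Q *P (A *P B)) ≋ (A *P (1P +P Q *P B))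
  factor = solve-∀ polyRing

infix 4 _≈_mod_
_≈_mod_ : Poly → Poly → Poly → Set
f ≈ g mod m = Σ Poly λ h → f ≋ g +P h *P m

≋⇒mod : ∀ {m f g} → f ≋ g → f ≈ g mod m
≋⇒mod {m} {f} {g} f≋g = [] , ≋-trans f≋g (≋-sym (+P-identityʳ g))

mod-sym : ∀ {m f g} → f ≈ g mod m → g ≈ f mod m
mod-sym {m} {f} {g} (h , f≋) = negP h , (begin
  g                          ≈⟨ move g h m ⟩
  (g +P h *P m) +P negP h *P m ≈⟨ +P-congˡ (negP h *P m) f≋ ⟨
  f +P negP h *P m           ∎)
  where
  open ≋-Reasoning
  move : ∀ g h m → g ≋ ((g +P h *P m) +P negP h *P m)
  move = solve-∀ polyRing

mod-trans : ∀ {m f g k} → f ≈ g mod m → g ≈ k mod m → f ≈ k mod m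
mod-trans {m} {f} {g} {k} (h₁ , f≋) (h₂ , g≋) = h₂ +P h₁ , (begin
  f                               ≈⟨ f≋ ⟩
  g +P h₁ *P m                    ≈⟨ +P-congˡ (h₁ *P m) g≋ ⟩
  (k +P h₂ *P m) +P h₁ *P m       ≈⟨ collect k h₂ h₁ m ⟩
  k +P (h₂ +P h₁) *P m            ∎)
  where
  open ≋-Reasoning
  collect : ∀ k h₂ h₁ m → ((k +P h₂ *P m) +P h₁ *P m) ≋ (k +P (h₂ +P h₁) *P m)
  collect = solve-∀ polyRing

modSetoid : Poly → Setoid _ _
modSetoid m = record
  { Carrier = Poly ; _≈_ = λ f g → f ≈ g mod m
  ; isEquivalence = record { refl = ≋⇒mod ≋-refl ; sym = mod-sym ; trans = mod-trans } }

module ModReasoning (m : Poly) = SetoidReasoning (modSetoid m)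

mod-scale : ∀ u {m f g} → f ≈ g mod m → (u *P f) ≈ (u *P g) mod u *P m
mod-scale u {m} {f} {g} (h , f≋) = h , ≋-trans (*P-congʳ u f≋) (expand u g h m)
  where
  expand : ∀ u g h m → (u *P (g +P h *P m)) ≋ (u *P g +P h *P (u *P m))
  expand = solve-∀ polyRing

mod-weaken : ∀ {d m f g} (c : Poly) → m ≋ c *P d → f ≈ g mod m → f ≈ g mod d
mod-weaken {d} {m} {f} {g} c m≋cd (h , f≋) =
  h *P c , ≋-trans f≋ (+P-congʳ g (≋-trans (*P-congʳ h m≋cd) (≋-sym (*P-assoc h c d))))

mod-*ʳ : ∀ {m f g} u → f ≈ g mod m → (f *P u) ≈ (g *P u) mod m
mod-*ʳ {m} {f} {g} u f≈g with mod-scale u f≈g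
... | h , uf≋ = h *P u , ≋-trans (≋-trans (*P-comm f u) uf≋) (reorder u g h m)
  where
  reorder : ∀ u g h m → (u *P g +P h *P (u *P m)) ≋ (g *P u +P (h *P u) *P m)
  reorder = solve-∀ polyRing

mod-+ : ∀ {m f f′ g g′} → f ≈ f′ mod m → g ≈ g′ mod m → (f +P g) ≈ (f′ +P g′) mod m
mod-+ {m} {f} {f′} {g} {g′} (h₁ , f≋) (h₂ , g≋) = h₁ +P h₂ , ≋-trans (+P-cong f≋ g≋) (collect f′ g′ h₁ h₂ m)
  where
  collect : ∀ f g h₁ h₂ m → ((f +P h₁ *P m) +P (g +P h₂ *P m)) ≋ ((f +P g) +P (h₁ +P h₂) *P m)
  collect = solve-∀ polyRing

mod-*ˡ : ∀ {m f g} u → f ≈ g mod m → (u *P f) ≈ (u *P g) mod m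
mod-*ˡ {m} {f} {g} u f≈g with mod-*ʳ u f≈g
... | h , fu≋ = h , ≋-trans (*P-comm u f) (≋-trans fu≋ (+P-congˡ (h *P m) (*P-comm g u)))

mod-negP : ∀ {m f g} → f ≈ g mod m → negP f ≈ negP g mod m
mod-negP {m} {f} {g} (h , f≋) = negP h , ≋-trans (negP-cong f≋) (distribute g h m)
  where
  distribute : ∀ g h m → negP (g +P h *P m) ≋ (negP g +P negP h *P m)
  distribute = solve-∀ polyRing

mod-resp : ∀ {m m′ f g} → m ≋ m′ → f ≈ g mod m → f ≈ g mod m′
mod-resp {m} {m′} m≋m′ = mod-weaken 1P (≋-trans m≋m′ (≋-sym (*P-identityˡ m′)))

^P-2 : ∀ m → (m *P m) ≋ (m ^P 2)
^P-2 m = *P-congʳ m (≋-sym (*P-identityʳ m))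

^P-3 : ∀ m → (m *P m *P m) ≋ (m ^P 3)
^P-3 m = ≋-trans (*P-assoc m m m) (*P-congʳ m (^P-2 m))

-- Products of q-integers and the q-Pochhammer symbol (q;q)_n

qfact : ℕ → Poly
qfact zero    = 1P
qfact (suc k) = qfact k *P qint (suc k)

falling : ℕ → ℕ → Poly
falling m zero    = 1P
falling m (suc k) = falling m k *P qint (m ∸ suc k)

rising : ℕ → ℕ → Poly
rising b zero    = 1P
rising b (suc k) = rising b k *P qint (suc (b + k))

qPoch-peel : ∀ n t → n ≡ suc t → qPoch qP n ≋ (qPoch qP t *P ((1P -P qP) *P qint n))
qPoch-peel .(suc t) t refl = *P-congʳ (qPoch qP t) (one-minus-qpow (suc t))

qPoch-qfact : ∀ k → qPoch qP k ≋ ((1P -P qP) ^P k *P qfact k)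
qPoch-qfact zero    = ≋-sym (*P-identityˡ 1P)
qPoch-qfact (suc k) = begin
  qPoch qP (suc k)                                            ≈⟨ qPoch-peel (suc k) k refl ⟩
  qPoch qP k *P ((1P -P qP) *P qint (suc k))                  ≈⟨ *P-congˡ ((1P -P qP) *P qint (suc k)) (qPoch-qfact k) ⟩
  ((1P -P qP) ^P k *P qfact k) *P ((1P -P qP) *P qint (suc k)) ≈⟨ move ((1P -P qP) ^P k) (qfact k) (1P -P qP) (qint (suc k)) ⟩
  (1P -P qP) ^P suc k *P qfact (suc k)                         ∎
  where
  open ≋-Reasoning
  move : ∀ uᵏ F u J → ((uᵏ *P F) *P (u *P J)) ≋ ((u *P uᵏ) *P (F *P J))
  move = solve-∀ polyRing

qPoch-falling : ∀ m k → k ≤ m ∸ 1 →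
  qPoch qP (m ∸ 1) ≋ (qPoch qP (m ∸ 1 ∸ k) *P ((1P -P qP) ^P k *P falling m k))
qPoch-falling m zero    _  = ≋-sym (*P-identityʳ _)
qPoch-falling m (suc k) k<n = begin
  qPoch qP n                                                          ≈⟨ qPoch-falling m k (ℕ.<⇒≤ k<n) ⟩
  qPoch qP (n ∸ k) *P ((1P -P qP) ^P k *P falling m k)                ≈⟨ *P-congˡ _ (qPoch-peel (n ∸ k) (n ∸ suc k) (ℕ.+-∸-assoc 1 k<n)) ⟩
  (qPoch qP (n ∸ suc k) *P ((1P -P qP) *P qint (n ∸ k))) *P ((1P -P qP) ^P k *P falling m k)
    ≈⟨ absorb (qPoch qP (n ∸ suc k)) (1P -P qP) (qint (n ∸ k)) ((1P -P qP) ^P k) (falling m k) ⟩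
  qPoch qP (n ∸ suc k) *P ((1P -P qP) ^P suc k *P (falling m k *P qint (n ∸ k)))
    ≡⟨ cong (λ i → qPoch qP (n ∸ suc k) *P ((1P -P qP) ^P suc k *P (falling m k *P qint i))) (ℕ.∸-+-assoc m 1 k) ⟩
  qPoch qP (n ∸ suc k) *P ((1P -P qP) ^P suc k *P falling m (suc k))  ∎
  where
  n = m ∸ 1
  open ≋-Reasoning
  absorb : ∀ A u x uᵏ P → ((A *P (u *P x)) *P (uᵏ *P P)) ≋ (A *P ((u *P uᵏ) *P (P *P x)))
  absorb = solve-∀ polyRing

qPoch-rising : ∀ b k → qPoch qP (b + k) ≋ (qPoch qP b *P ((1P -P qP) ^P k *P rising b k))
qPoch-rising b zero    = ≋-trans (≡⇒≋ (cong (qPoch qP) (ℕ.+-identityʳ b))) (≋-sym (*P-identityʳ _))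
qPoch-rising b (suc k) = begin
  qPoch qP (b + suc k)                                                  ≈⟨ qPoch-peel (b + suc k) (b + k) (ℕ.+-suc b k) ⟩
  qPoch qP (b + k) *P ((1P -P qP) *P qint (b + suc k))                  ≈⟨ *P-congˡ _ (qPoch-rising b k) ⟩
  (qPoch qP b *P ((1P -P qP) ^P k *P rising b k)) *P ((1P -P qP) *P qint (b + suc k))
    ≈⟨ move (qPoch qP b) (1P -P qP) (qint (b + suc k)) ((1P -P qP) ^P k) (rising b k) ⟩
  qPoch qP b *P ((1P -P qP) ^P suc k *P (rising b k *P qint (b + suc k)))
    ≡⟨ cong (λ i → qPoch qP b *P ((1P -P qP) ^P suc k *P (rising b k *P qint i))) (ℕ.+-suc b k) ⟩
  qPoch qP b *P ((1P -P qP) ^P suc k *P rising b (suc k))               ∎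
  where
  open ≋-Reasoning
  move : ∀ A u x uᵏ P → ((A *P (uᵏ *P P)) *P (u *P x)) ≋ (A *P ((u *P uᵏ) *P (P *P x)))
  move = solve-∀ polyRing

gaussB-quotient : ∀ n k → k ≤ n → gaussB n k ≡ (qPoch qP n // (qPoch qP k *P qPoch qP (n ∸ k)))
gaussB-quotient n k k≤n with k ℕ.≤? n
... | yes _   = refl
... | no  k≰n = contradiction k≤n k≰n

record TermsOverQint (f : ℕ → RatF) (g : ℕ → Poly) : Set where
  field
    num-term : ∀ j → num (f j) ≋ g j
    den-term : ∀ j → den (f j) ≋ qint j
open TermsOverQint

-- The numerator of Σ_{j=1}^k g_j/[j]_q over the common denominator [k]_q!.
sumNum : (ℕ → Poly) → ℕ → Poly
sumNum g zero    = []
sumNum g (suc k) = sumNum g k *P qint (suc k) +P g (suc k) *P qfact k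

sum-den : ∀ {f g} → TermsOverQint f g → ∀ k → den (sumR f k) ≋ qfact k
sum-den t zero    = ≋-refl
sum-den t (suc k) = *P-cong (sum-den t k) (den-term t (suc k))

sum-num : ∀ {f g} → TermsOverQint f g → ∀ k → num (sumR f k) ≋ sumNum g k
sum-num t zero    = ≋-refl
sum-num t (suc k) = +P-cong (*P-cong (sum-num t k) (den-term t (suc k)))
                            (*P-cong (num-term t (suc k)) (sum-den t k))

sumNum-+ : ∀ {g g′ h} → (∀ j → h j ≋ g j +P g′ j) → ∀ k → sumNum h k ≋ (sumNum g k +P sumNum g′ k)
sumNum-+                 h≋ zero    = ≋-refl
sumNum-+ {g} {g′} {h} h≋ (suc k) = begin
  sumNum h k *P J +P h (suc k) *P F                             ≈⟨ +P-cong (*P-congˡ J (sumNum-+ h≋ k)) (*P-congˡ F (h≋ (suc k))) ⟩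
  (sumNum g k +P sumNum g′ k) *P J +P (g (suc k) +P g′ (suc k)) *P F
    ≈⟨ distribute (sumNum g k) (sumNum g′ k) J (g (suc k)) (g′ (suc k)) F ⟩
  (sumNum g k *P J +P g (suc k) *P F) +P (sumNum g′ k *P J +P g′ (suc k) *P F) ∎
  where
  J = qint (suc k)
  F = qfact k
  open ≋-Reasoning
  distribute : ∀ A A′ J a a′ F → ((A +P A′) *P J +P (a +P a′) *P F) ≋ ((A *P J +P a *P F) +P (A′ *P J +P a′ *P F))
  distribute = solve-∀ polyRing

harmonicTerms : TermsOverQint (λ j → invR (fromP (qint j))) (λ _ → 1P)
harmonicTerms = record { num-term = λ j → ≋-refl ; den-term = λ j → ≋-refl }

qpowTerms : TermsOverQint (λ j → fromP (qP ^P j) *R invR (fromP (qint j))) (qP ^P_)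
qpowTerms = record { num-term = λ j → *P-identityʳ _ ; den-term = λ j → *P-identityˡ _ }

onePlusQpowTerms : TermsOverQint (λ j → fromP (1P +P qP ^P j) *R invR (fromP (qint j))) (λ j → 1P +P qP ^P j)
onePlusQpowTerms = record { num-term = λ j → *P-identityʳ _ ; den-term = λ j → *P-identityˡ _ }

-- Units modulo m: f is comaximal with m if U f + V m = 1 for some U, V.
-- Comaximality is closed under products and implies coprimality in ℤ[q].

Comax : Poly → Poly → Set
Comax f m = Σ Poly λ U → Σ Poly λ V → (U *P f +P V *P m) ≋ 1P

comax-sym : ∀ {f m} → Comax f m → Comax m f
comax-sym {f} {m} (U , V , e) = V , U , ≋-trans (+P-comm (V *P m) (U *P f)) e

comax-1 : ∀ m → Comax 1P m
comax-1 m = 1P , [] , ≋-trans (+P-identityʳ (1P *P 1P)) (*P-identityˡ 1P)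

comax-* : ∀ {f g m} → Comax f m → Comax g m → Comax (f *P g) m
comax-* {f} {g} {m} (U₁ , V₁ , e₁) (U₂ , V₂ , e₂) =
  U₁ *P U₂ , (U₁ *P f) *P V₂ +P V₁ *P (U₂ *P g +P V₂ *P m) , (begin
    (U₁ *P U₂) *P (f *P g) +P ((U₁ *P f) *P V₂ +P V₁ *P (U₂ *P g +P V₂ *P m)) *P m
      ≈⟨ expand U₁ U₂ f g V₁ V₂ m ⟩
    (U₁ *P f +P V₁ *P m) *P (U₂ *P g +P V₂ *P m)   ≈⟨ *P-cong e₁ e₂ ⟩
    1P *P 1P                                        ≈⟨ *P-identityˡ 1P ⟩
    1P                                              ∎)
  where
  open ≋-Reasoning
  expand : ∀ U₁ U₂ f g V₁ V₂ m →
    ((U₁ *P U₂) *P (f *P g) +P ((U₁ *P f) *P V₂ +P V₁ *P (U₂ *P g +P V₂ *P m)) *P m)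
      ≋ ((U₁ *P f +P V₁ *P m) *P (U₂ *P g +P V₂ *P m))
  expand = solve-∀ polyRing

comax-pow : ∀ {f m} → Comax f m → ∀ e → Comax (f ^P e) m
comax-pow {m = m} c zero    = comax-1 m
comax-pow         c (suc e) = comax-* c (comax-pow c e)

comax⇒coprime : ∀ {f m} → Comax f m → CoprimeP f m
comax⇒coprime {f} {m} (U , V , e) d (c₁ , c₁d≈f) (c₂ , c₂d≈m) = U *P c₁ +P V *P c₂ , coeffs (begin
  (U *P c₁ +P V *P c₂) *P d       ≈⟨ expand U V c₁ c₂ d ⟩
  U *P (c₁ *P d) +P V *P (c₂ *P d) ≈⟨ +P-cong (*P-congʳ U (mk c₁d≈f)) (*P-congʳ V (mk c₂d≈m)) ⟩
  U *P f +P V *P m                ≈⟨ e ⟩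
  1P                              ∎)
  where
  open ≋-Reasoning
  expand : ∀ U V c₁ c₂ d → ((U *P c₁ +P V *P c₂) *P d) ≋ (U *P (c₁ *P d) +P V *P (c₂ *P d))
  expand = solve-∀ polyRing

-- q is a unit modulo [p]_q for p ≥ 1, since [p]_q = 1 + q [p-1]_q.
comax-q : ∀ p′ → Comax qP (qint (suc p′))
comax-q p′ = negP (qint p′) , 1P , (begin
  negP (qint p′) *P qP +P 1P *P qint (suc p′)           ≈⟨ +P-congʳ (negP (qint p′) *P qP) (*P-congʳ 1P (qint-suc p′)) ⟩
  negP (qint p′) *P qP +P 1P *P (1P +P qP *P qint p′)   ≈⟨ cancel (qint p′) qP ⟩
  1P                                                    ∎)
  where
  open ≋-Reasoning
  cancel : ∀ A q → (negP A *P q +P 1P *P (1P +P q *P A)) ≋ 1P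
  cancel = solve-∀ polyRing

-- An integer Bézout relation 1 + y n = x m lifts to q-integers:
-- [x m]_q = [1 + y n]_q gives [m]_q·geomSum m x - q·geomSum n y·[n]_q = 1.
comax-from-Bézout : ∀ m n x y → suc (y * n) ≡ x * m → Comax (qint m) (qint n)
comax-from-Bézout m n x y eq = geomSum m x , negP (qP *P geomSum n y) , (begin
  geomSum m x *P qint m +P negP (qP *P geomSum n y) *P qint n
    ≈⟨ +P-congˡ (negP (qP *P geomSum n y) *P qint n) (≋-trans (*P-comm (geomSum m x) (qint m)) (≋-sym (qint-* x m))) ⟩
  qint (x * m) +P negP (qP *P geomSum n y) *P qint n
    ≈⟨ +P-congˡ (negP (qP *P geomSum n y) *P qint n) (≡⇒≋ (cong qint (≡.sym eq))) ⟩
  qint (suc (y * n)) +P negP (qP *P geomSum n y) *P qint n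
    ≈⟨ +P-congˡ (negP (qP *P geomSum n y) *P qint n)
         (≋-trans (qint-suc (y * n)) (+P-congʳ 1P (*P-congʳ qP (qint-* y n)))) ⟩
  (1P +P qP *P (qint n *P geomSum n y)) +P negP (qP *P geomSum n y) *P qint n
    ≈⟨ cancel qP (qint n) (geomSum n y) ⟩
  1P ∎)
  where
  open ≋-Reasoning
  cancel : ∀ q A B → ((1P +P q *P (A *P B)) +P negP (q *P B) *P A) ≋ 1P
  cancel = solve-∀ polyRing

comax-qint : ∀ {p j} → Prime p → 1 ≤ j → j < p → Comax (qint j) (qint p)
comax-qint {p} {j@(suc _)} p-prime _ j<p
  with coprime-Bézout (Coprime.sym (prime⇒coprime p-prime j<p))
... | Bézout.+- x y eq = comax-from-Bézout j p x y eq
... | Bézout.-+ x y eq = comax-sym (comax-from-Bézout p j y x eq)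

congruence-criterion : ∀ {m r a b c d} (X G F c′ d′ : Poly) →
  a ≋ X *P G → b ≋ X *P F → c ≋ c′ → d ≋ d′ → Comax F m → Comax d′ m →
  (G *P d′) ≈ (c′ *P F) mod (m ^P r) → CongR m r (a // b) (c // d)
congruence-criterion {m} {r} {a} {b} {c} {d} X G F c′ d′ a≋ b≋ c≋ d≋ F-unit d′-unit (h , Gd′≋) =
  h *P M , F *P d′ , (h , coeffs (≋-refl {h *P M})) ,
  comax⇒coprime (comax-* F-unit d′-unit) , coeffs (begin
    (h *P M) *P (b *P d)                                 ≈⟨ *P-congʳ (h *P M) (*P-cong b≋ d≋) ⟩
    (h *P M) *P ((X *P F) *P d′)                         ≈⟨ rearrange X F d′ c′ h M ⟩
    (F *P d′) *P (X *P (c′ *P F +P h *P M) -P c′ *P (X *P F))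
      ≈⟨ *P-congʳ (F *P d′) (+P-congˡ (negP (c′ *P (X *P F))) (*P-congʳ X Gd′≋)) ⟨
    (F *P d′) *P (X *P (G *P d′) -P c′ *P (X *P F))      ≈⟨ *P-congʳ (F *P d′) (+P-cong (*P-assoc X G d′) (negP-cong (*P-congˡ (X *P F) c≋))) ⟨
    (F *P d′) *P ((X *P G) *P d′ -P c *P (X *P F))       ≈⟨ *P-congʳ (F *P d′) (+P-cong (*P-cong a≋ d≋) (negP-cong (*P-congʳ c b≋))) ⟨
    (F *P d′) *P (a *P d -P c *P b)                      ∎)
  where
  M = m ^P r
  open ≋-Reasoning
  rearrange : ∀ X F d′ c′ h M →
    ((h *P M) *P ((X *P F) *P d′)) ≋ ((F *P d′) *P (X *P (c′ *P F +P h *P M) -P c′ *P (X *P F)))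
  rearrange = solve-∀ polyRing

comax-qfact : ∀ {p k} → Prime p → k < p → Comax (qfact k) (qint p)
comax-qfact {p} {zero}  p-prime _   = comax-1 (qint p)
comax-qfact {p} {suc k} p-prime k<p =
  comax-* (comax-qfact p-prime (ℕ.<-trans (ℕ.n<1+n k) k<p)) (comax-qint p-prime (s≤s z≤n) k<p)

comax-falling : ∀ {p′ k} → Prime (suc p′) → k ≤ p′ → Comax (falling (suc p′) k) (qint (suc p′))
comax-falling {p′} {zero}  p-prime _    = comax-1 (qint (suc p′))
comax-falling {p′} {suc k} p-prime k<p′ =
  comax-* (comax-falling p-prime (ℕ.<⇒≤ k<p′))
          (comax-qint p-prime (ℕ.m<n⇒0<n∸m k<p′) (s≤s (ℕ.m∸n≤m p′ k)))

-- The three expansions behind the theorem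

triangular : ℕ → ℕ
triangular k = (k + 1) C 2

triangular-suc : ∀ k → triangular (suc k) ≡ suc k + triangular k
triangular-suc k = ≡.trans (≡.sym (nCk+nC[k+1]≡[n+1]C[k+1] (k + 1) 1))
                           (cong (_+ triangular k) (≡.trans (nC1≡n (k + 1)) (ℕ.+-comm k 1)))

-- The sign (-1)^k as a constant polynomial; note sgn (suc k) = negP (sgn k).
sgn : ℕ → Poly
sgn k = constP (-[1+ 0 ] ℤ.^ k)

sgn² : ∀ k → (sgn k *P sgn k) ≋ 1P
sgn² zero    = *P-identityˡ 1P
sgn² (suc k) = ≋-trans (neg² (sgn k)) (sgn² k)
  where
  neg² : ∀ S → (negP S *P negP S) ≋ (S *P S)
  neg² = solve-∀ polyRing

sgn-cancel : ∀ k A B → ((sgn k *P A) *P (sgn k *P B)) ≋ (A *P B)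
sgn-cancel k A B = begin
  (sgn k *P A) *P (sgn k *P B)   ≈⟨ regroup (sgn k) A B ⟩
  (sgn k *P sgn k) *P (A *P B)   ≈⟨ *P-congˡ (A *P B) (sgn² k) ⟩
  1P *P (A *P B)                 ≈⟨ *P-identityˡ (A *P B) ⟩
  A *P B                         ∎
  where
  open ≋-Reasoning
  regroup : ∀ S A B → ((S *P A) *P (S *P B)) ≋ ((S *P S) *P (A *P B))
  regroup = solve-∀ polyRing

-- Since q^j [m-j]_q = [m]_q - [j]_q, the product q^(1+⋯+k) [m-1]_q ⋯ [m-k]_q
-- is (-1)^k ([k]_q! - [m]_q Σ_{j≤k} [k]_q!/[j]_q) modulo [m]_q².
falling-expansion : ∀ m k → k ≤ m →
  (qP ^P triangular k *P falling m k) ≈ (sgn k *P (qfact k -P qint m *P sumNum (λ _ → 1P) k)) mod (qint m *P qint m)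
falling-expansion m zero    _   = ≋⇒mod (base (qint m))
  where
  base : ∀ X → (1P *P 1P) ≋ (1P *P (1P -P X *P []))
  base = solve-∀ polyRing
falling-expansion m (suc k) k<m = begin
  qP ^P triangular (suc k) *P (falling m k *P qint (m ∸ suc k))
    ≈⟨ ≋⇒mod (*P-congˡ (falling m k *P qint (m ∸ suc k)) (≋-trans (≡⇒≋ (cong (qP ^P_) (triangular-suc k))) (qpow-+ (suc k) (triangular k)))) ⟩
  (qP ^P suc k *P qP ^P triangular k) *P (falling m k *P qint (m ∸ suc k))
    ≈⟨ ≋⇒mod (regroup (qP ^P suc k) (qP ^P triangular k) (falling m k) (qint (m ∸ suc k))) ⟩
  (qP ^P triangular k *P falling m k) *P (qP ^P suc k *P qint (m ∸ suc k))
    ≈⟨ ≋⇒mod (*P-congʳ (qP ^P triangular k *P falling m k) (qint-∸ m (suc k) k<m)) ⟩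
  (qP ^P triangular k *P falling m k) *P (X -P J)
    ≈⟨ mod-*ʳ (X -P J) (falling-expansion m k (ℕ.<⇒≤ k<m)) ⟩
  (S *P (F -P X *P N)) *P (X -P J)
    ≈⟨ negP (S *P N) , expand S F X N J ⟩
  negP S *P (F *P J -P X *P (N *P J +P 1P *P F)) ∎
  where
  S = sgn k
  F = qfact k
  N = sumNum (λ _ → 1P) k
  X = qint m
  J = qint (suc k)
  open ModReasoning (X *P X)
  regroup : ∀ a b c d → ((a *P b) *P (c *P d)) ≋ ((b *P c) *P (a *P d))
  regroup = solve-∀ polyRing
  expand : ∀ S F X N J → ((S *P (F -P X *P N)) *P (X -P J))
    ≋ (negP S *P (F *P J -P X *P (N *P J +P 1P *P F)) +P negP (S *P N) *P (X *P X))
  expand = solve-∀ polyRing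

-- Since [b+1+j]_q = [j]_q + q^j [b+1]_q, with P = [b+1]_q the product
-- [b+1]_q ⋯ [b+1+j]_q is P ([j]_q! + P Σ_{i≤j} q^i [j]_q!/[i]_q) modulo P³.
rising-expansion : ∀ b j → let P = qint (suc b) in
  rising b (suc j) ≈ (P *P (qfact j +P P *P sumNum (qP ^P_) j)) mod (P *P P *P P)
rising-expansion b zero    = ≋⇒mod (≋-trans (*P-congʳ 1P (≡⇒≋ (cong (λ i → qint (suc i)) (ℕ.+-identityʳ b)))) (base (qint (suc b))))
  where
  base : ∀ P → (1P *P P) ≋ (P *P (1P +P P *P []))
  base = solve-∀ polyRing
rising-expansion b (suc j) = begin
  rising b (suc j) *P qint (suc (b + suc j))
    ≈⟨ ≋⇒mod (*P-congʳ (rising b (suc j)) (≋-trans (≡⇒≋ (cong qint (ℕ.+-comm (suc b) (suc j)))) (qint-+ (suc j) (suc b)))) ⟩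
  rising b (suc j) *P (J +P Q *P P)
    ≈⟨ mod-*ʳ (J +P Q *P P) (rising-expansion b j) ⟩
  (P *P (E +P P *P N)) *P (J +P Q *P P)
    ≈⟨ N *P Q , expand P E N J Q ⟩
  P *P (E *P J +P P *P (N *P J +P Q *P E)) ∎
  where
  P = qint (suc b)
  E = qfact j
  N = sumNum (qP ^P_) j
  J = qint (suc j)
  Q = qP ^P suc j
  open ModReasoning (P *P P *P P)
  expand : ∀ P E N J Q → ((P *P (E +P P *P N)) *P (J +P Q *P P))
    ≋ (P *P (E *P J +P P *P (N *P J +P Q *P E)) +P (N *P Q) *P (P *P P *P P))
  expand = solve-∀ polyRing

-- q^n ≡ 1 modulo [n]_q, because 1 - q^n = (1 - q)[n]_q.
qpow≈1 : ∀ n → (qP ^P n) ≈ 1P mod (qint n)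
qpow≈1 n = negP (1P -P qP) , (begin
  qP ^P n                              ≈⟨ move (qP ^P n) ⟩
  1P +P negP (1P -P qP ^P n)           ≈⟨ +P-congʳ 1P (negP-cong (one-minus-qpow n)) ⟩
  1P +P negP ((1P -P qP) *P qint n)    ≈⟨ +P-congʳ 1P (neg-* (1P -P qP) (qint n)) ⟩
  1P +P negP (1P -P qP) *P qint n      ∎)
  where
  open ≋-Reasoning
  move : ∀ Q → Q ≋ (1P +P negP (1P -P Q))
  move = solve-∀ polyRing
  neg-* : ∀ A B → negP (A *P B) ≋ (negP A *P B)
  neg-* = solve-∀ polyRing

geomSum≈ : ∀ n a → geomSum n a ≈ constP (+ a) mod (qint n)
geomSum≈ n zero    = ≋⇒mod (≋-sym 0∷[]≋[])
geomSum≈ n (suc a) = begin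
  1P +P qP ^P n *P geomSum n a   ≈⟨ mod-+ (≋⇒mod ≋-refl) (mod-*ʳ (geomSum n a) (qpow≈1 n)) ⟩
  1P +P 1P *P geomSum n a        ≈⟨ ≋⇒mod (+P-congʳ 1P (*P-identityˡ (geomSum n a))) ⟩
  1P +P geomSum n a              ≈⟨ mod-+ (≋⇒mod (≋-refl {1P})) (geomSum≈ n a) ⟩
  1P +P constP (+ a)             ∎
  where open ModReasoning (qint n)

qint-*≈ : ∀ a p → qint (a * p) ≈ (constP (+ a) *P qint p) mod (qint p *P qint p)
qint-*≈ a p = begin
  qint (a * p)                   ≈⟨ ≋⇒mod (qint-* a p) ⟩
  qint p *P geomSum p a          ≈⟨ mod-scale (qint p) (geomSum≈ p a) ⟩
  qint p *P constP (+ a)         ≈⟨ ≋⇒mod (*P-comm (qint p) _) ⟩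
  constP (+ a) *P qint p         ∎
  where open ModReasoning (qint p *P qint p)

-- The three congruences

-- After cancelling (q;q)_{ap-1-k} (1-q)^k this is the statement that
-- [ap-1]_q ⋯ [ap-k]_q · q^{binom(k+1,2)} ≡ (-1)^k ([k]_q! - a[p]_q Σ [k]_q!/[j]_q),
-- which follows from falling-expansion because [ap]_q ≡ a[p]_q and [p]_q ∣ [ap]_q.
gauss-ap-1 : ∀ p′ a k → Prime (suc p′) → 1 ≤ a → k ≤ p′ →
  CongR (qint (suc p′)) 2
    (gaussB (a * suc p′ ∸ 1) k)
    (signR k *R invR (fromP (qP ^P ((k + 1) C 2)))
      *R (1R -R fromP (constP (+ a) *P qint (suc p′))
               *R sumR (λ j → invR (fromP (qint j))) k))
gauss-ap-1 p′ a k p-prime a≥1 k≤p′ =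
  subst (λ L → CongR P 2 L rhs) (≡.sym (gaussB-quotient n k k≤n))
    (congruence-criterion {r = 2} (qPoch qP (n ∸ k) *P Uᵏ) (falling m k) F c′ (Q *P F)
      (≋-trans (qPoch-falling m k k≤n) (≋-sym (*P-assoc (qPoch qP (n ∸ k)) Uᵏ (falling m k))))
      (≋-trans (*P-congˡ (qPoch qP (n ∸ k)) (qPoch-qfact k)) (swap Uᵏ F (qPoch qP (n ∸ k))))
      c≋ d≋
      (comax-qfact p-prime (s≤s k≤p′))
      (comax-* (comax-pow (comax-q p′) (triangular k)) (comax-qfact p-prime (s≤s k≤p′)))
      (mod-resp (^P-2 P) key))
  where
  p = suc p′
  P = qint p
  m = a * p
  n = m ∸ 1
  p≤m : p ≤ m
  p≤m = ℕ.m≤n*m p a {{>-nonZero a≥1}}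
  k≤n : k ≤ n
  k≤n = ℕ.∸-monoˡ-≤ 1 (ℕ.≤-trans (s≤s k≤p′) p≤m)
  Uᵏ = (1P -P qP) ^P k
  A = constP (+ a)
  S = sgn k
  Q = qP ^P triangular k
  F = qfact k
  N = sumNum (λ _ → 1P) k
  c′ = S *P (F -P (A *P P) *P N)
  harmonic = λ j → invR (fromP (qint j))
  rhs = signR k *R invR (fromP Q) *R (1R -R fromP (A *P P) *R sumR harmonic k)
  swap : ∀ u F C → ((u *P F) *P C) ≋ ((C *P u) *P F)
  swap = solve-∀ polyRing
  c≋ : num rhs ≋ c′
  c≋ = ≋-trans (clear S (A *P P) (den (sumR harmonic k)) (num (sumR harmonic k)))
               (*P-congʳ S (+P-cong (sum-den harmonicTerms k) (negP-cong (*P-congʳ (A *P P) (sum-num harmonicTerms k)))))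
    where
    clear : ∀ S AP D N → ((S *P 1P) *P (1P *P (1P *P D) -P (AP *P N) *P 1P)) ≋ (S *P (D -P AP *P N))
    clear = solve-∀ polyRing
  d≋ : den rhs ≋ (Q *P F)
  d≋ = ≋-trans (clear Q (den (sumR harmonic k))) (*P-congʳ Q (sum-den harmonicTerms k))
    where
    clear : ∀ Q D → ((1P *P Q) *P (1P *P (1P *P D))) ≋ (Q *P D)
    clear = solve-∀ polyRing
  -- [ap]_q² is a multiple of [p]_q², so falling-expansion holds modulo [p]_q²
  [m]²-multiple : (qint m *P qint m) ≋ ((geomSum p a *P geomSum p a) *P (P *P P))
  [m]²-multiple = ≋-trans (*P-cong (qint-* a p) (qint-* a p)) (regroup P (geomSum p a))
    where
    regroup : ∀ P W → ((P *P W) *P (P *P W)) ≋ ((W *P W) *P (P *P P))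
    regroup = solve-∀ polyRing
  key : (falling m k *P (Q *P F)) ≈ (c′ *P F) mod (P *P P)
  key = begin
    falling m k *P (Q *P F)           ≈⟨ ≋⇒mod (regroup (falling m k) Q F) ⟩
    (Q *P falling m k) *P F           ≈⟨ mod-*ʳ F (mod-weaken (geomSum p a *P geomSum p a) [m]²-multiple (falling-expansion m k (ℕ.≤-trans (ℕ.n≤1+n k) (ℕ.≤-trans (s≤s k≤p′) p≤m)))) ⟩
    (S *P (F -P qint m *P N)) *P F    ≈⟨ mod-*ʳ F (mod-*ˡ S (mod-+ (≋⇒mod (≋-refl {F})) (mod-negP (mod-*ʳ N (qint-*≈ a p))))) ⟩
    c′ *P F                           ∎
    where
    open ModReasoning (P *P P)
    regroup : ∀ G Q F → (G *P (Q *P F)) ≋ ((Q *P G) *P F)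
    regroup = solve-∀ polyRing

-- [p-1+k choose k]_q ≡ [p]_q/[k]_q (1 + [p]_q Σ_{j<k} q^j/[j]_q)  mod [p]_q³.
-- After cancelling (q;q)_{p-1} (1-q)^k this is rising-expansion.
gauss-p-1+k : ∀ p′ k′ → Prime (suc p′) → suc k′ ≤ p′ →
  CongR (qint (suc p′)) 3
    (gaussB (p′ + suc k′) (suc k′))
    ((fromP (qint (suc p′)) *R invR (fromP (qint (suc k′))))
      *R (1R +R fromP (qint (suc p′))
               *R sumR (λ j → fromP (qP ^P j) *R invR (fromP (qint j))) k′))
gauss-p-1+k p′ k′ p-prime k≤p′ =
  subst (λ L → CongR P 3 L rhs) (≡.sym (gaussB-quotient (p′ + k) k (ℕ.m≤n+m k p′)))
    (congruence-criterion {r = 3} (qPoch qP p′ *P Uᵏ) (rising p′ k) (qfact k) c′ (K *P E)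
      (≋-trans (qPoch-rising p′ k) (≋-sym (*P-assoc (qPoch qP p′) Uᵏ (rising p′ k))))
      (≋-trans (*P-cong (qPoch-qfact k) (≡⇒≋ (cong (qPoch qP) (ℕ.m+n∸n≡m p′ k))))
               (swap Uᵏ (qfact k) (qPoch qP p′)))
      c≋ d≋
      (comax-qfact p-prime k<p)
      (comax-* (comax-qint p-prime (s≤s z≤n) k<p) (comax-qfact p-prime (ℕ.<-trans (ℕ.n<1+n k′) k<p)))
      (mod-resp (^P-3 P) key))
  where
  p = suc p′
  k = suc k′
  k<p : k < p
  k<p = s≤s k≤p′
  P = qint p
  K = qint k
  Uᵏ = (1P -P qP) ^P k
  E = qfact k′
  N = sumNum (qP ^P_) k′
  c′ = P *P (E +P P *P N)
  qpowOverQint = λ j → fromP (qP ^P j) *R invR (fromP (qint j))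
  rhs = (fromP P *R invR (fromP K)) *R (1R +R fromP P *R sumR qpowOverQint k′)
  swap : ∀ u F C → ((u *P F) *P C) ≋ ((C *P u) *P F)
  swap = solve-∀ polyRing
  c≋ : num rhs ≋ c′
  c≋ = ≋-trans (clear P (den (sumR qpowOverQint k′)) (num (sumR qpowOverQint k′)))
               (*P-congʳ P (+P-cong (sum-den qpowTerms k′) (*P-congʳ P (sum-num qpowTerms k′))))
    where
    clear : ∀ P D N → ((P *P 1P) *P (1P *P (1P *P D) +P (P *P N) *P 1P)) ≋ (P *P (D +P P *P N))
    clear = solve-∀ polyRing
  d≋ : den rhs ≋ (K *P E)
  d≋ = ≋-trans (clear K (den (sumR qpowOverQint k′))) (*P-congʳ K (sum-den qpowTerms k′))
    where
    clear : ∀ K D → ((1P *P K) *P (1P *P (1P *P D))) ≋ (K *P D)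
    clear = solve-∀ polyRing
  key : (rising p′ k *P (K *P E)) ≈ (c′ *P qfact k) mod (P *P P *P P)
  key = begin
    rising p′ k *P (K *P E)   ≈⟨ mod-*ʳ (K *P E) (rising-expansion p′ k′) ⟩
    c′ *P (K *P E)            ≈⟨ ≋⇒mod (*P-congʳ c′ (*P-comm K E)) ⟩
    c′ *P qfact k             ∎
    where open ModReasoning (P *P P *P P)

-- After cancellation the left side is [p]_q ⋯ [p+k-1]_q / ([p-1]_q ⋯ [p-k]_q); the
-- numerator is given by rising-expansion, and the denominator, multiplied by
-- q^{binom(k+1,2)}, by falling-expansion with m = p.
gauss-ratio : ∀ p′ k′ → Prime (suc p′) → suc k′ ≤ p′ →
  CongR (qint (suc p′)) 3
    (gaussB (p′ + suc k′) (suc k′) *R invR (gaussB p′ (suc k′)))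
    ((signR (suc k′) *R fromP (qP ^P ((suc k′ + 1) C 2)) *R fromP (qint (suc p′)) *R invR (fromP (qint (suc k′))))
      *R (1R +R fromP (qint (suc p′)) *R invR (fromP (qint (suc k′)))
             +R fromP (qint (suc p′))
               *R sumR (λ j → fromP (1P +P qP ^P j) *R invR (fromP (qint j))) k′))
gauss-ratio p′ k′ p-prime k≤p′ =
  subst (λ L → CongR P 3 L rhs)
    (≡.sym (cong₂ (λ x y → x *R invR y) (gaussB-quotient (p′ + k) k (ℕ.m≤n+m k p′)) (gaussB-quotient p′ k k≤p′)))
    (congruence-criterion {r = 3} X (rising p′ k) (falling p k) c′ (K *P K *P E)
      num≋ den≋ c≋ d≋
      (comax-falling p-prime k≤p′)
      (comax-* (comax-* K-unit K-unit) (comax-qfact p-prime (ℕ.<-trans (ℕ.n<1+n k′) k<p)))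
      (mod-resp (^P-3 P) key))
  where
  p = suc p′
  k = suc k′
  k<p : k < p
  k<p = s≤s k≤p′
  P = qint p
  K = qint k
  K-unit = comax-qint p-prime (s≤s z≤n) k<p
  Uᵏ = (1P -P qP) ^P k
  S = sgn k
  Q = qP ^P triangular k
  E = qfact k′
  N₁ = sumNum (λ _ → 1P) k′
  N₂ = sumNum (qP ^P_) k′
  -- the numerator of the bracket, over [k]_q [k-1]_q!
  B = (K +P P) *P E +P P *P (N₁ +P N₂) *P K
  c′ = S *P Q *P P *P B
  onePlusQpowOverQint = λ j → fromP (1P +P qP ^P j) *R invR (fromP (qint j))
  rhs = (signR k *R fromP Q *R fromP P *R invR (fromP K))
          *R (1R +R fromP P *R invR (fromP K) +R fromP P *R sumR onePlusQpowOverQint k′)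
  -- the common factor cancelled from the quotient of Pochhammer symbols
  X = qPoch qP p′ *P Uᵏ *P Uᵏ *P qfact k *P qPoch qP (p′ ∸ k)
  num≋ : (qPoch qP (p′ + k) *P (qPoch qP k *P qPoch qP (p′ ∸ k))) ≋ (X *P rising p′ k)
  num≋ = ≋-trans (*P-cong (qPoch-rising p′ k) (*P-congˡ (qPoch qP (p′ ∸ k)) (qPoch-qfact k)))
                 (regroup (qPoch qP p′) Uᵏ (rising p′ k) (qfact k) (qPoch qP (p′ ∸ k)))
    where
    regroup : ∀ A u G F Z → ((A *P (u *P G)) *P ((u *P F) *P Z)) ≋ ((A *P u *P u *P F *P Z) *P G)
    regroup = solve-∀ polyRing
  den≋ : ((qPoch qP k *P qPoch qP (p′ + k ∸ k)) *P qPoch qP p′) ≋ (X *P falling p k)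
  den≋ = ≋-trans (*P-cong (*P-cong (qPoch-qfact k) (≡⇒≋ (cong (qPoch qP) (ℕ.m+n∸n≡m p′ k)))) (qPoch-falling p k k≤p′))
                 (regroup (qPoch qP p′) Uᵏ (falling p k) (qfact k) (qPoch qP (p′ ∸ k)))
    where
    regroup : ∀ A u G F Z → (((u *P F) *P A) *P (Z *P (u *P G))) ≋ ((A *P u *P u *P F *P Z) *P G)
    regroup = solve-∀ polyRing
  c≋ : num rhs ≋ c′
  c≋ = ≋-trans (clear S Q P K (den (sumR onePlusQpowOverQint k′)) (num (sumR onePlusQpowOverQint k′)))
               (*P-congʳ (S *P Q *P P) (+P-cong (*P-congʳ (K +P P) (sum-den onePlusQpowTerms k′))
                 (*P-congˡ K (*P-congʳ P (≋-trans (sum-num onePlusQpowTerms k′) (sumNum-+ (λ j → ≋-refl) k′))))))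
    where
    clear : ∀ S Q P K D N →
      ((((S *P Q) *P P) *P 1P) *P ((1P *P (1P *P K) +P (P *P 1P) *P 1P) *P (1P *P D) +P (P *P N) *P (1P *P (1P *P K))))
        ≋ (S *P Q *P P *P ((K +P P) *P D +P P *P N *P K))
    clear = solve-∀ polyRing
  d≋ : den rhs ≋ (K *P K *P E)
  d≋ = ≋-trans (clear K (den (sumR onePlusQpowOverQint k′))) (*P-congʳ (K *P K) (sum-den onePlusQpowTerms k′))
    where
    clear : ∀ K D → ((((1P *P 1P) *P 1P) *P K) *P ((1P *P (1P *P K)) *P (1P *P D))) ≋ (K *P K *P D)
    clear = solve-∀ polyRing
  denominator≈ : ((S *P (P *P B)) *P (Q *P falling p k)) ≈ ((S *P (P *P B)) *P (S *P (E *P K -P P *P (N₁ *P K +P 1P *P E)))) mod (P *P P *P P)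
  denominator≈ = mod-weaken (S *P B) (regroup S P B) (mod-scale (S *P (P *P B)) (falling-expansion p k (ℕ.<⇒≤ k<p)))
    where
    regroup : ∀ S P B → ((S *P (P *P B)) *P (P *P P)) ≋ ((S *P B) *P (P *P P *P P))
    regroup = solve-∀ polyRing
  key : (rising p′ k *P (K *P K *P E)) ≈ (c′ *P falling p k) mod (P *P P *P P)
  key = begin
    rising p′ k *P (K *P K *P E)
      ≈⟨ mod-*ʳ (K *P K *P E) (rising-expansion p′ k′) ⟩
    (P *P (E +P P *P N₂)) *P (K *P K *P E)
      ≈⟨ (N₁ *P K +P 1P *P E) *P (E +P (N₁ +P N₂) *P K) , expand P E N₁ N₂ K ⟩
    P *P B *P (E *P K -P P *P (N₁ *P K +P 1P *P E))
      ≈⟨ ≋⇒mod (≋-sym (sgn-cancel k (P *P B) (E *P K -P P *P (N₁ *P K +P 1P *P E)))) ⟩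
    (S *P (P *P B)) *P (S *P (E *P K -P P *P (N₁ *P K +P 1P *P E)))
      ≈⟨ mod-sym denominator≈ ⟩
    (S *P (P *P B)) *P (Q *P falling p k)
      ≈⟨ ≋⇒mod (regroup S P B Q (falling p k)) ⟩
    c′ *P falling p k ∎
    where
    open ModReasoning (P *P P *P P)
    expand : ∀ P E N₁ N₂ K →
      ((P *P (E +P P *P N₂)) *P (K *P K *P E))
        ≋ (P *P ((K +P P) *P E +P P *P (N₁ +P N₂) *P K) *P (E *P K -P P *P (N₁ *P K +P 1P *P E))
           +P ((N₁ *P K +P 1P *P E) *P (E +P (N₁ +P N₂) *P K)) *P (P *P P *P P))
    expand = solve-∀ polyRing
    regroup : ∀ S P B Q F → ((S *P (P *P B)) *P (Q *P F)) ≋ ((S *P Q *P P *P B) *P F)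
    regroup = solve-∀ polyRing

mainTheorem6 : (p a : ℕ) → Prime p → 1 ≤ a → (k : ℕ) → 1 ≤ k → k ≤ p ∸ 1 →
    CongR (qint p) 2
      (gaussB (a * p ∸ 1) k)
      (signR k *R invR (fromP (qP ^P ((k + 1) C 2)))
        *R (1R -R fromP (constP (+ a) *P qint p)
                 *R sumR (λ j → invR (fromP (qint j))) k))
    × CongR (qint p) 3
      (gaussB (p ∸ 1 + k) k)
      ((fromP (qint p) *R invR (fromP (qint k)))
        *R (1R +R fromP (qint p)
                 *R sumR (λ j → fromP (qP ^P j) *R invR (fromP (qint j))) (k ∸ 1)))
    × CongR (qint p) 3
      (gaussB (p ∸ 1 + k) k *R invR (gaussB (p ∸ 1) k))
      ((signR k *R fromP (qP ^P ((k + 1) C 2)) *R fromP (qint p) *R invR (fromP (qint k)))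
        *R (1R +R fromP (qint p) *R invR (fromP (qint k))
               +R fromP (qint p)
                 *R sumR (λ j → fromP (1P +P qP ^P j) *R invR (fromP (qint j))) (k ∸ 1)))
mainTheorem6 zero     a p-prime = ⊥-elim (¬prime[0] p-prime)
mainTheorem6 (suc p′) a p-prime a≥1 (suc k′) _ k≤p′ =
  gauss-ap-1 p′ a (suc k′) p-prime a≥1 k≤p′ ,
  gauss-p-1+k p′ k′ p-prime k≤p′ ,
  gauss-ratio p′ k′ p-prime k≤p′
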